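{- For every term $t$ and every path formula (temporal objective) $\chi$ of $\mathcal{L}_{\mathrm{HDMAS}}$, whenever the left-hand side is a formula of $\mathcal{L}_{\mathrm{HDMAS}}$, the following logical equivalences hold: 1. $\forall y_1\langle\langle y_1,t\rangle\rangle\chi\equiv\langle\langle 0,t\rangle\rangle\chi[0/y_1]$; 2. $\exists y_2\langle\langle t,y_2\rangle\rangle\chi\equiv\langle\langle t,0\rangle\rangle\chi[0/y_2]$; 3. $\forall y_1\exists y_2\langle\langle y_1,y_2\rangle\rangle\chi\equiv\langle\langle 0,0\rangle\rangle\chi[0/y_1,0/y_2]$; 4. $\exists y_2\forall y_1\langle\langle y_1,y_2\rangle\rangle\chi\equiv\langle\langle 0,0\rangle\rangle\chi[0/y_1,0/y_2]$; 5. $\forall y_2\forall y_1\langle\langle y_1,y_2\rangle\rangle\chi\equiv\forall y_2\langle\langle 0,y_2\rangle\rangle\chi[0/y_1]$; 6. $\forall y_1\forall y_2\langle\langle y_1,y_2\rangle\rangle\chi\equiv\forall y_2\langle\langle 0,y_2\rangle\rangle\chi[0/y_1]$; 7. $\exists y_1\exists y_2\langle\langle y_1,y_2\rangle\rangle\chi\equiv\exists y_1\langle\langle y_1,0\rangle\rangle\chi[0/y_2]$; 8. $\exists y_2\exists y_1\langle\langle y_1,y_2\rangle\rangle\chi\equiv\exists y_1\langle\langle y_1,0\rangle\rangle\chi[0/y_2]$.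
   Context: HDMAS setting: countable agents $\mathit{Ag}$; actions $\mathit{Act}=\{act_1,\dots,act_n\}$, idle action $\varepsilon$, $\mathit{Act}^+=\mathit{Act}\cup\{\varepsilon\}$; action counters $x_1,\dots,x_n,x_\varepsilon$ with $\mu(act_i)=x_i$, $\mu(\varepsilon)=x_\varepsilon$. Guards are quantifier-free Presburger formulas over $x_1,\dots,x_n$. An action distribution is $\eta:X'\to\mathbb{N}$ with $X'\subseteq\{x_1,\dots,x_n,x_\varepsilon\}$; $H_m$ is the set of those whose values sum to $m$; $\eta_1\oplus\eta_2$ is the pointwise sum. An HDMAS is $\mathcal{M}=\langle\mathit{Ag},\mathit{Act}^+,S,d,\delta,\mathit{AP},\lambda\rangle$ with states $S$, available actions $d(s)\ni\varepsilon$, guards $\delta(s,s')$ over $\mu[d(s)]$ such that each distribution with domain $\mu[d(s)]$ satisfies $\delta(s,s')$ for exactly one $s'$, and labelling $\lambda$; the (partial) transition function $\Delta(s,\eta)$ is the state $s'$ with $\eta\models\delta(s,s')$. An abstract joint strategy for $C$ agents is a map $\rho_C$ with $\rho_C(s)\in H_C$ of domain $\mu[d(s)]$; its outcome plays against $N$ agents, $\mathit{out}(s,\rho_C,N)$, are sequences $s_0s_1\dots$, $s_0=s$, $s_{i+1}=\Delta(s_i,\rho_C(s_i)\oplus\eta_i)$ for some $\eta_i\in H_N$ of domain $\mu[d(s_i)]$. Logic $\mathcal{L}_{\mathrm{HDMAS}}$: agent counters $y_1,y_2$, parameters $z_1,z_2,\dots$, terms $T=\{y_1,y_2\}\cup\{z_i\}\cup\mathbb{N}$.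 Path formulas (temporal objectives): $\mathsf{X}\varphi$, $\mathsf{G}\varphi$, $\psi\,\mathsf{U}\,\varphi$. State formulas: $\top$, $p$, $\neg\varphi$, $\varphi\wedge\varphi$, $\varphi\vee\varphi$, $\langle\langle t_1,t_2\rangle\rangle\chi$ with $t_1\in T\setminus\{y_2\}$, $t_2\in T\setminus\{y_1\}$, and $\forall y\varphi$, $\exists y\varphi$ ($y\in\{y_1,y_2\}$) provided all free occurrences of $y$ in $\varphi$ are in the scope of an even number of negations. Assignments $\theta:T\to\mathbb{N}$ fix numerals. Semantics: $\mathcal{M},s,\theta\models\langle\langle t_1,t_2\rangle\rangle\chi$ iff there is an abstract joint strategy for $\theta(t_1)$ agents all of whose outcome plays from $s$ against $\theta(t_2)$ agents satisfy $\chi$ (with standard meanings of $\mathsf{X},\mathsf{G},\mathsf{U}$ along plays); quantifiers range over $\mathbb{N}$; other clauses standard. $\varphi\equiv\psi$ means they are true at exactly the same (model, state, assignment) triples. $\chi[k/t]$ replaces free occurrences of $t$ by $k$. -}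

module Defs where

open import Data.Nat using (ℕ; zero; suc; _+_; _*_; _≤_; _<_)
open import Data.Fin using (Fin)
import Data.Fin as F
open import Data.Bool using (Bool; true; false; not; if_then_else_; T)
open import Data.Product using (Σ; _×_; _,_; proj₁; ∃; ∃!)
open import Data.Sum using (_⊎_)
open import Data.Unit using (⊤)
open import Data.Empty using (⊥)
open import Relation.Nullary using (¬_)
open import Relation.Binary.PropositionalEquality using (_≡_; _≢_)

-- Act⁺ = {act_1,…,act_n} ∪ {ε}.  The counter map μ is the identity on
-- this type: the counter x_i is indexed by (act i) and x_ε by ε.
data Act⁺ (n : ℕ) : Set where
  act : Fin n → Act⁺ n
  ε   : Act⁺ n

sumFin : ∀ {m} → (Fin m → ℕ) → ℕ
sumFin {zero}  f = 0
sumFin {suc m} f = f F.zero + sumFin (λ i → f (F.suc i))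

-- An action distribution η : X' → ℕ with domain X' ⊆ {x_1,…,x_n,x_ε}
-- is represented by its extension by 0 outside X'.
Distr : ℕ → Set
Distr n = Act⁺ n → ℕ

ActSet : ℕ → Set
ActSet n = Act⁺ n → Bool

HasDom : ∀ {n} → ActSet n → Distr n → Set
HasDom D η = ∀ a → D a ≡ false → η a ≡ 0

total : ∀ {n} → Distr n → ℕ
total {n} η = η ε + sumFin (λ i → η (act i))

InH : ∀ {n} → ActSet n → ℕ → Distr n → Set
InH D m η = HasDom D η × total η ≡ m

_⊕_ : ∀ {n} → Distr n → Distr n → Distr n
(η₁ ⊕ η₂) a = η₁ a + η₂ a

data PTerm (n : ℕ) : Set where
  var   : Fin n → PTerm n
  const : ℕ → PTerm n
  _+ₚ_  : PTerm n → PTerm n → PTerm n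
  _·ₚ_  : ℕ → PTerm n → PTerm n

data Guard (n : ℕ) : Set where
  trueₚ falseₚ : Guard n
  _≤ₚ_ _=ₚ_    : PTerm n → PTerm n → Guard n
  cong-mod     : ℕ → PTerm n → PTerm n → Guard n
  ¬ₚ_          : Guard n → Guard n
  _∧ₚ_ _∨ₚ_    : Guard n → Guard n → Guard n

evalT : ∀ {n} → (Fin n → ℕ) → PTerm n → ℕ
evalT v (var i)    = v i
evalT v (const k)  = k
evalT v (t +ₚ u)   = evalT v t + evalT v u
evalT v (k ·ₚ t)   = k * evalT v t

evalG : ∀ {n} → (Fin n → ℕ) → Guard n → Set
evalG v trueₚ  = ⊤
evalG v falseₚ = ⊥
evalG v (t ≤ₚ u) = evalT v t ≤ evalT v u
evalG v (t =ₚ u) = evalT v t ≡ evalT v u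
evalG v (cong-mod m t u) = ∃ λ k → ∃ λ l → evalT v t + k * m ≡ evalT v u + l * m
evalG v (¬ₚ g) = ¬ evalG v g
evalG v (g ∧ₚ h) = evalG v g × evalG v h
evalG v (g ∨ₚ h) = evalG v g ⊎ evalG v h

TermVarsIn : ∀ {n} → (Fin n → Bool) → PTerm n → Set
TermVarsIn P (var i)   = T (P i)
TermVarsIn P (const k) = ⊤
TermVarsIn P (t +ₚ u)  = TermVarsIn P t × TermVarsIn P u
TermVarsIn P (k ·ₚ t)  = TermVarsIn P t

GuardVarsIn : ∀ {n} → (Fin n → Bool) → Guard n → Set
GuardVarsIn P trueₚ  = ⊤
GuardVarsIn P falseₚ = ⊤
GuardVarsIn P (t ≤ₚ u) = TermVarsIn P t × TermVarsIn P u
GuardVarsIn P (t =ₚ u) = TermVarsIn P t × TermVarsIn P u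
GuardVarsIn P (cong-mod m t u) = TermVarsIn P t × TermVarsIn P u
GuardVarsIn P (¬ₚ g) = GuardVarsIn P g
GuardVarsIn P (g ∧ₚ h) = GuardVarsIn P g × GuardVarsIn P h
GuardVarsIn P (g ∨ₚ h) = GuardVarsIn P g × GuardVarsIn P h

-- η ⊨ g  (guards only mention x_1,…,x_n, not x_ε)
_⊨ᵍ_ : ∀ {n} → Distr n → Guard n → Set
η ⊨ᵍ g = evalG (λ i → η (act i)) g

record HDMAS (AP : Set) (n : ℕ) (S : Set) : Set where
  field
    d      : S → ActSet n
    d-ε    : ∀ s → d s ε ≡ true
    δ      : S → S → Guard n
    δ-vars : ∀ s s' → GuardVarsIn (λ i → d s (act i)) (δ s s')
    δ-det  : ∀ s η → HasDom (d s) η → ∃! _≡_ (λ s' → η ⊨ᵍ δ s s')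
    lab    : S → AP → Bool

module _ {AP : Set} {n : ℕ} {S : Set} (M : HDMAS AP n S) where
  open HDMAS M

  -- Δ(s, η) = s'   (as a relation; functional by δ-det)
  Step : S → Distr n → S → Set
  Step s η s' = η ⊨ᵍ δ s s'

  Strategy : ℕ → Set
  Strategy C = (s : S) → Σ (Distr n) (InH (d s) C)

  Play : Set
  Play = ℕ → S

  Outcome : ∀ {C} → S → Strategy C → ℕ → Play → Set
  Outcome s ρ N π =
    π 0 ≡ s ×
    (∀ i → Σ (Distr n) λ η → InH (d (π i)) N η ×
             Step (π i) (proj₁ (ρ (π i)) ⊕ η) (π (suc i)))

data Var : Set where
  y₁ y₂ : Var

_==ᵥ_ : Var → Var → Bool
y₁ ==ᵥ y₁ = true
y₂ ==ᵥ y₂ = true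
_  ==ᵥ _  = false

data Term : Set where
  ag  : Var → Term
  par : ℕ → Term
  nat : ℕ → Term

mutual
  data State (AP : Set) : Set where
    ⊤ᶠ   : State AP
    atom : AP → State AP
    ¬ᶠ_  : State AP → State AP
    _∧ᶠ_ _∨ᶠ_ : State AP → State AP → State AP
    ⟪_,_⟫_ : Term → Term → Path AP → State AP
    ∀ᶠ ∃ᶠ : Var → State AP → State AP

  data Path (AP : Set) : Set where
    Xᶠ Gᶠ : State AP → Path AP
    _Uᶠ_  : State AP → State AP → Path AP

-- "all free occurrences of y are in the scope of an even number of
-- negations", relative to an initial parity b (true = even so far).
OkTerm : Var → Bool → Term → Set
OkTerm y true  t = ⊤
OkTerm y false t = t ≢ ag y

mutual
  EvenOcc : ∀ {AP} → Var → Bool → State AP → Set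
  EvenOcc y b ⊤ᶠ = ⊤
  EvenOcc y b (atom p) = ⊤
  EvenOcc y b (¬ᶠ φ) = EvenOcc y (not b) φ
  EvenOcc y b (φ ∧ᶠ ψ) = EvenOcc y b φ × EvenOcc y b ψ
  EvenOcc y b (φ ∨ᶠ ψ) = EvenOcc y b φ × EvenOcc y b ψ
  EvenOcc y b (⟪ t₁ , t₂ ⟫ χ) = OkTerm y b t₁ × OkTerm y b t₂ × EvenOccP y b χ
  EvenOcc y b (∀ᶠ y' φ) = if y ==ᵥ y' then ⊤ else EvenOcc y b φ
  EvenOcc y b (∃ᶠ y' φ) = if y ==ᵥ y' then ⊤ else EvenOcc y b φ

  EvenOccP : ∀ {AP} → Var → Bool → Path AP → Set
  EvenOccP y b (Xᶠ φ) = EvenOcc y b φ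
  EvenOccP y b (Gᶠ φ) = EvenOcc y b φ
  EvenOccP y b (φ Uᶠ ψ) = EvenOcc y b φ × EvenOcc y b ψ

mutual
  WF : ∀ {AP} → State AP → Set
  WF ⊤ᶠ = ⊤
  WF (atom p) = ⊤
  WF (¬ᶠ φ) = WF φ
  WF (φ ∧ᶠ ψ) = WF φ × WF ψ
  WF (φ ∨ᶠ ψ) = WF φ × WF ψ
  WF (⟪ t₁ , t₂ ⟫ χ) = t₁ ≢ ag y₂ × t₂ ≢ ag y₁ × WFP χ
  WF (∀ᶠ y φ) = EvenOcc y true φ × WF φ
  WF (∃ᶠ y φ) = EvenOcc y true φ × WF φ

  WFP : ∀ {AP} → Path AP → Set
  WFP (Xᶠ φ) = WF φ
  WFP (Gᶠ φ) = WF φ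
  WFP (φ Uᶠ ψ) = WF φ × WF ψ

substT : Var → ℕ → Term → Term
substT y k (ag y') = if y ==ᵥ y' then nat k else ag y'
substT y k t = t

mutual
  subst : ∀ {AP} → Var → ℕ → State AP → State AP
  subst y k ⊤ᶠ = ⊤ᶠ
  subst y k (atom p) = atom p
  subst y k (¬ᶠ φ) = ¬ᶠ subst y k φ
  subst y k (φ ∧ᶠ ψ) = subst y k φ ∧ᶠ subst y k ψ
  subst y k (φ ∨ᶠ ψ) = subst y k φ ∨ᶠ subst y k ψ
  subst y k (⟪ t₁ , t₂ ⟫ χ) = ⟪ substT y k t₁ , substT y k t₂ ⟫ substP y k χ
  subst y k (∀ᶠ y' φ) = ∀ᶠ y' (if y ==ᵥ y' then φ else subst y k φ)
  subst y k (∃ᶠ y' φ) = ∃ᶠ y' (if y ==ᵥ y' then φ else subst y k φ)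

  substP : ∀ {AP} → Var → ℕ → Path AP → Path AP
  substP y k (Xᶠ φ) = Xᶠ (subst y k φ)
  substP y k (Gᶠ φ) = Gᶠ (subst y k φ)
  substP y k (φ Uᶠ ψ) = subst y k φ Uᶠ subst y k ψ

-- assignments θ : T → ℕ fixing numerals: given by values of y₁,y₂,z_i
record Assign : Set where
  field
    yv : Var → ℕ
    zv : ℕ → ℕ
open Assign

⟦_⟧ : Term → Assign → ℕ
⟦ ag y  ⟧ θ = yv θ y
⟦ par i ⟧ θ = zv θ i
⟦ nat k ⟧ θ = k

_[_↦_] : Assign → Var → ℕ → Assign
yv (θ [ y ↦ k ]) y' = if y ==ᵥ y' then k else yv θ y'
zv (θ [ y ↦ k ]) = zv θ

module _ {AP : Set} {n : ℕ} {S : Set} (M : HDMAS AP n S) where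
  open HDMAS M
  mutual
    Sat : S → Assign → State AP → Set
    Sat s θ ⊤ᶠ = ⊤
    Sat s θ (atom p) = T (lab s p)
    Sat s θ (¬ᶠ φ) = ¬ Sat s θ φ
    Sat s θ (φ ∧ᶠ ψ) = Sat s θ φ × Sat s θ ψ
    Sat s θ (φ ∨ᶠ ψ) = Sat s θ φ ⊎ Sat s θ ψ
    Sat s θ (⟪ t₁ , t₂ ⟫ χ) =
      Σ (Strategy M (⟦ t₁ ⟧ θ)) λ ρ →
        ∀ π → Outcome M s ρ (⟦ t₂ ⟧ θ) π → SatP π θ χ
    Sat s θ (∀ᶠ y φ) = ∀ k → Sat s (θ [ y ↦ k ]) φ
    Sat s θ (∃ᶠ y φ) = ∃ λ k → Sat s (θ [ y ↦ k ]) φ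

    SatP : Play M → Assign → Path AP → Set
    SatP π θ (Xᶠ φ) = Sat (π 1) θ φ
    SatP π θ (Gᶠ φ) = ∀ i → Sat (π i) θ φ
    SatP π θ (φ Uᶠ ψ) = ∃ λ j → Sat (π j) θ ψ × (∀ i → i < j → Sat (π i) θ φ)

_≋_ : ∀ {AP} → State AP → State AP → Set₁
_≋_ {AP} φ ψ = ∀ (n : ℕ) (S : Set) (M : HDMAS AP n S) (s : S) (θ : Assign) →
  (Sat M s θ φ → Sat M s θ ψ) × (Sat M s θ ψ → Sat M s θ φ)

module Submission where

-- Two facts about a fixed model carry the proof.
--   (a) Coalition monotonicity: whatever C agents can enforce against N
--       opponents, C' ≥ C agents can enforce against N' ≤ N opponents.  The
--       extra coalition members, and the opponents that are no longer there,
--       simply play the idle action ε, which no guard can observe.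
--   (b) Polarity: if every free occurrence of y lies under an even number of
--       negations, then satisfaction is preserved when y₁ is increased or y₂
--       is decreased (y₁ counts coalition members, y₂ opponents, and terms
--       are placed so that y₁ only counts the coalition and y₂ only the
--       opponents).  This is proved together with its dual for odd positions.
-- From (b), ∀ y₁ φ is equivalent to φ with y₁ := 0 (the least favourable
-- value for the coalition) and ∃ y₂ φ to φ with y₂ := 0 (the most favourable
-- one).  Each of the eight equivalences then follows by applying these two
-- eliminations, the substitution lemma (substituting k for y is the same as
-- assigning k to y) and the coincidence lemma (satisfaction only depends on
-- the values of terms).

open import Defs
open import Algebra.Properties.CommutativeSemigroup using (xy∙z≈xz∙y)
open import Data.Bool using (true; false; if_then_else_)
open import Data.Empty using (⊥-elim)
open import Data.Nat using (ℕ; _+_; _∸_; _≤_; z≤n)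
open import Data.Nat.Properties
  using (≤-refl; ≤-reflexive; m+[n∸m]≡n; +-commutativeSemigroup)
open import Data.Product using (_×_; Σ; ∃; _,_; proj₁; proj₂)
import Data.Product
import Data.Sum
open import Data.Product.Function.Dependent.Propositional using (Σ-⇔)
open import Data.Product.Function.NonDependent.Propositional using (_×-⇔_)
open import Data.Sum.Function.Propositional using (_⊎-⇔_)
open import Function.Bundles using (_⇔_; mk⇔; Equivalence)
open import Function.Construct.Composition using (_⇔-∘_)
open import Function.Construct.Identity using (↠-id; ⇔-id)
open import Function.Construct.Symmetry using (⇔-sym)
open import Function.Related.Propositional using (equivalence; module EquationalReasoning)
open import Function.Related.TypeIsomorphisms using (¬-cong-⇔)
open import Relation.Binary.PropositionalEquality using (_≡_; refl; sym; trans; cong; _≢_)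
open import Relation.Nullary.Negation using (contradiction)

open Assign
open Equivalence using (to; from)

Π-⇔ : ∀ {X : Set} {A B : X → Set} → (∀ x → A x ⇔ B x) → (∀ x → A x) ⇔ (∀ x → B x)
Π-⇔ A⇔B = mk⇔ (λ f x → to (A⇔B x) (f x)) (λ g x → from (A⇔B x) (g x))

∃-⇔ : ∀ {A B : ℕ → Set} → (∀ x → A x ⇔ B x) → ∃ A ⇔ ∃ B
∃-⇔ A⇔B = Σ-⇔ (↠-id ℕ) (λ {x} → A⇔B x)

-- η together with k further agents playing the idle action ε.  On the
-- counters x₁,…,xₙ it is η itself, so guards cannot tell them apart.
withIdle : ∀ {n} → ℕ → Distr n → Distr n
withIdle k η ε       = η ε + k
withIdle k η (act i) = η (act i)

withIdle-InH : ∀ {n} {D : ActSet n} {m m' η} k → D ε ≡ true → m + k ≡ m' →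
               InH D m η → InH D m' (withIdle k η)
withIdle-InH {D = D} {m' = m'} {η = η} k Dε m+k≡m' (dom , tot) = dom' , tot'
  where
    dom' : HasDom D (withIdle k η)
    dom' (act i) D≡false = dom (act i) D≡false
    dom' ε       D≡false = contradiction (trans (sym Dε) D≡false) λ ()

    tot' : (η ε + k) + sumFin (λ i → η (act i)) ≡ m'
    tot' = trans (xy∙z≈xz∙y +-commutativeSemigroup (η ε) k _)
                 (trans (cong (_+ k) tot) m+k≡m')

module Enforcement {AP : Set} {n : ℕ} {S : Set} (M : HDMAS AP n S) where
  open HDMAS M

  Enforces : S → ℕ → ℕ → (Play M → Set) → Set
  Enforces s C N P = Σ (Strategy M C) λ ρ → ∀ π → Outcome M s ρ N π → P π

  enforce-mono : ∀ {s C C' N N'} {P Q : Play M → Set} → C ≤ C' → N' ≤ N →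
                 (∀ π → P π → Q π) → Enforces s C N P → Enforces s C' N' Q
  enforce-mono {s} {C} {C'} {N} {N'} C≤C' N'≤N P⇒Q (ρ , wins) =
    ρ' , λ π out → P⇒Q π (wins π (replay-outcome π out))
    where
      -- the C' ∸ C newcomers idle
      ρ' : Strategy M C'
      ρ' x = withIdle (C' ∸ C) (proj₁ (ρ x)) ,
             withIdle-InH (C' ∸ C) (d-ε x) (m+[n∸m]≡n C≤C') (proj₂ (ρ x))

      -- a move of N' opponents against ρ' is a move of N opponents
      -- against ρ, the N ∸ N' extra opponents idling; the joint action
      -- counts on x₁,…,xₙ coincide, so the same guard fires.
      replay-move : ∀ {x x'} →
        Σ (Distr n) (λ η → InH (d x) N' η × Step M x (proj₁ (ρ' x) ⊕ η) x') →
        Σ (Distr n) (λ η → InH (d x) N η × Step M x (proj₁ (ρ x) ⊕ η) x')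
      replay-move {x} (η , η∈H , step) =
        withIdle (N ∸ N') η , withIdle-InH (N ∸ N') (d-ε x) (m+[n∸m]≡n N'≤N) η∈H , step

      replay-outcome : ∀ π → Outcome M s ρ' N' π → Outcome M s ρ N π
      replay-outcome π (start , moves) = start , λ i → replay-move (moves i)

  enforce-cong : ∀ {s C C' N N'} {P Q : Play M → Set} → C ≡ C' → N ≡ N' →
                 (∀ π → P π ⇔ Q π) → Enforces s C N P ⇔ Enforces s C' N' Q
  enforce-cong C≡C' N≡N' P⇔Q =
    mk⇔ (enforce-mono (≤-reflexive C≡C') (≤-reflexive (sym N≡N')) (λ π → to (P⇔Q π)))
        (enforce-mono (≤-reflexive (sym C≡C')) (≤-reflexive N≡N') (λ π → from (P⇔Q π)))

infix 4 _≈ₐ_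
_≈ₐ_ : Assign → Assign → Set
θ ≈ₐ θ' = ∀ t → ⟦ t ⟧ θ ≡ ⟦ t ⟧ θ'

update-cong : ∀ {θ θ'} → θ ≈ₐ θ' → ∀ y k → θ [ y ↦ k ] ≈ₐ θ' [ y ↦ k ]
update-cong θ≈θ' y₁ k (ag y₁) = refl
update-cong θ≈θ' y₁ k (ag y₂) = θ≈θ' (ag y₂)
update-cong θ≈θ' y₂ k (ag y₁) = θ≈θ' (ag y₁)
update-cong θ≈θ' y₂ k (ag y₂) = refl
update-cong θ≈θ' y k (par i)  = θ≈θ' (par i)
update-cong θ≈θ' y k (nat m)  = refl

update-overwrite : ∀ θ y k j → θ [ y ↦ j ] ≈ₐ θ [ y ↦ k ] [ y ↦ j ]
update-overwrite θ y₁ k j (ag y₁) = refl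
update-overwrite θ y₁ k j (ag y₂) = refl
update-overwrite θ y₂ k j (ag y₁) = refl
update-overwrite θ y₂ k j (ag y₂) = refl
update-overwrite θ y k j (par i)  = refl
update-overwrite θ y k j (nat m)  = refl

other : Var → Var
other y₁ = y₂
other y₂ = y₁

update-swap : ∀ θ y k j → θ [ other y ↦ j ] [ y ↦ k ] ≈ₐ θ [ y ↦ k ] [ other y ↦ j ]
update-swap θ y₁ k j (ag y₁) = refl
update-swap θ y₁ k j (ag y₂) = refl
update-swap θ y₂ k j (ag y₁) = refl
update-swap θ y₂ k j (ag y₂) = refl
update-swap θ y k j (par i)  = refl
update-swap θ y k j (nat m)  = refl

substT-sound : ∀ y k t θ → ⟦ substT y k t ⟧ θ ≡ ⟦ t ⟧ (θ [ y ↦ k ])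
substT-sound y₁ k (ag y₁) θ = refl
substT-sound y₁ k (ag y₂) θ = refl
substT-sound y₂ k (ag y₁) θ = refl
substT-sound y₂ k (ag y₂) θ = refl
substT-sound y k (par i)  θ = refl
substT-sound y k (nat m)  θ = refl

substT-fresh : ∀ y k t → t ≢ ag y → substT y k t ≡ t
substT-fresh y₁ k (ag y₁) t≢y = ⊥-elim (t≢y refl)
substT-fresh y₁ k (ag y₂) t≢y = refl
substT-fresh y₂ k (ag y₁) t≢y = refl
substT-fresh y₂ k (ag y₂) t≢y = ⊥-elim (t≢y refl)
substT-fresh y k (par i)  t≢y = refl
substT-fresh y k (nat m)  t≢y = refl

-- Polarity of the agent counters: as a value of y₁ (coalition size) a
-- larger number is better for the coalition, as a value of y₂ (number of
-- opponents) a smaller one.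
Better : Var → ℕ → ℕ → Set
Better y₁ k k' = k ≤ k'
Better y₂ k k' = k' ≤ k

record Improves (y : Var) (θ θ' : Assign) : Set where
  constructor improves
  field
    elsewhere : ∀ t → t ≢ ag y → ⟦ t ⟧ θ ≡ ⟦ t ⟧ θ'
    at-y      : Better y (yv θ y) (yv θ' y)
open Improves

update-elsewhere : ∀ θ y k k' t → t ≢ ag y → ⟦ t ⟧ (θ [ y ↦ k ]) ≡ ⟦ t ⟧ (θ [ y ↦ k' ])
update-elsewhere θ y₁ k k' (ag y₁) t≢y = ⊥-elim (t≢y refl)
update-elsewhere θ y₁ k k' (ag y₂) t≢y = refl
update-elsewhere θ y₂ k k' (ag y₁) t≢y = refl
update-elsewhere θ y₂ k k' (ag y₂) t≢y = ⊥-elim (t≢y refl)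
update-elsewhere θ y k k' (par i)  t≢y = refl
update-elsewhere θ y k k' (nat m)  t≢y = refl

update-improves : ∀ θ y {k k'} → Better y k k' → Improves y (θ [ y ↦ k ]) (θ [ y ↦ k' ])
update-improves θ y₁ {k} {k'} k≤k' = improves (update-elsewhere θ y₁ k k') k≤k'
update-improves θ y₂ {k} {k'} k'≤k = improves (update-elsewhere θ y₂ k k') k'≤k

update-elsewhere-cong : ∀ {y θ θ'} → (∀ t → t ≢ ag y → ⟦ t ⟧ θ ≡ ⟦ t ⟧ θ') →
  ∀ y' j t → t ≢ ag y → ⟦ t ⟧ (θ [ y' ↦ j ]) ≡ ⟦ t ⟧ (θ' [ y' ↦ j ])
update-elsewhere-cong agree y₁ j (ag y₁) t≢y = refl
update-elsewhere-cong agree y₁ j (ag y₂) t≢y = agree (ag y₂) t≢y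
update-elsewhere-cong agree y₂ j (ag y₁) t≢y = agree (ag y₁) t≢y
update-elsewhere-cong agree y₂ j (ag y₂) t≢y = refl
update-elsewhere-cong agree y' j (par i) t≢y = agree (par i) t≢y
update-elsewhere-cong agree y' j (nat m) t≢y = refl

rebind-same : ∀ {y θ θ'} → Improves y θ θ' → ∀ j → θ [ y ↦ j ] ≈ₐ θ' [ y ↦ j ]
rebind-same {y₁} θ≼θ' j (ag y₁) = refl
rebind-same {y₁} θ≼θ' j (ag y₂) = elsewhere θ≼θ' (ag y₂) λ ()
rebind-same {y₂} θ≼θ' j (ag y₁) = elsewhere θ≼θ' (ag y₁) λ ()
rebind-same {y₂} θ≼θ' j (ag y₂) = refl
rebind-same θ≼θ' j (par i) = elsewhere θ≼θ' (par i) λ ()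
rebind-same θ≼θ' j (nat m) = refl

rebind-other : ∀ {y θ θ'} → Improves y θ θ' → ∀ j → Improves y (θ [ other y ↦ j ]) (θ' [ other y ↦ j ])
rebind-other {y₁} (improves agree better) j = improves (update-elsewhere-cong agree y₂ j) better
rebind-other {y₂} (improves agree better) j = improves (update-elsewhere-cong agree y₁ j) better

-- Well-formedness puts y₂ only in opponent position, so the coalition
-- term can only grow ...
coalition-grows : ∀ {y θ θ'} → Improves y θ θ' → ∀ t → t ≢ ag y₂ → ⟦ t ⟧ θ ≤ ⟦ t ⟧ θ'
coalition-grows {y₁} θ≼θ' (ag y₁) t≢y₂ = at-y θ≼θ'
coalition-grows {y₂} θ≼θ' (ag y₂) t≢y₂ = ⊥-elim (t≢y₂ refl)
coalition-grows {y₁} θ≼θ' (ag y₂) t≢y₂ = ≤-reflexive (elsewhere θ≼θ' (ag y₂) λ ())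
coalition-grows {y₂} θ≼θ' (ag y₁) t≢y₂ = ≤-reflexive (elsewhere θ≼θ' (ag y₁) λ ())
coalition-grows θ≼θ' (par i) t≢y₂ = ≤-reflexive (elsewhere θ≼θ' (par i) λ ())
coalition-grows θ≼θ' (nat m) t≢y₂ = ≤-refl

-- ... and, symmetrically, the opponent term can only shrink.
opponents-shrink : ∀ {y θ θ'} → Improves y θ θ' → ∀ t → t ≢ ag y₁ → ⟦ t ⟧ θ' ≤ ⟦ t ⟧ θ
opponents-shrink {y₂} θ≼θ' (ag y₂) t≢y₁ = at-y θ≼θ'
opponents-shrink {y₁} θ≼θ' (ag y₁) t≢y₁ = ⊥-elim (t≢y₁ refl)
opponents-shrink {y₁} θ≼θ' (ag y₂) t≢y₁ = ≤-reflexive (sym (elsewhere θ≼θ' (ag y₂) λ ()))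
opponents-shrink {y₂} θ≼θ' (ag y₁) t≢y₁ = ≤-reflexive (sym (elsewhere θ≼θ' (ag y₁) λ ()))
opponents-shrink θ≼θ' (par i) t≢y₁ = ≤-reflexive (sym (elsewhere θ≼θ' (par i) λ ()))
opponents-shrink θ≼θ' (nat m) t≢y₁ = ≤-refl

module Semantics {AP : Set} {n : ℕ} {S : Set} (M : HDMAS AP n S) where
  open Enforcement M

  mutual
    agree-⇔ : ∀ {s θ θ'} → θ ≈ₐ θ' → ∀ φ → Sat M s θ φ ⇔ Sat M s θ' φ
    agree-⇔ θ≈θ' ⊤ᶠ       = ⇔-id _
    agree-⇔ θ≈θ' (atom p) = ⇔-id _
    agree-⇔ θ≈θ' (¬ᶠ φ)   = ¬-cong-⇔ (agree-⇔ θ≈θ' φ)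
    agree-⇔ θ≈θ' (φ ∧ᶠ ψ) = agree-⇔ θ≈θ' φ ×-⇔ agree-⇔ θ≈θ' ψ
    agree-⇔ θ≈θ' (φ ∨ᶠ ψ) = agree-⇔ θ≈θ' φ ⊎-⇔ agree-⇔ θ≈θ' ψ
    agree-⇔ θ≈θ' (⟪ t₁ , t₂ ⟫ χ) =
      enforce-cong (θ≈θ' t₁) (θ≈θ' t₂) (λ π → agreeP-⇔ θ≈θ' χ)
    agree-⇔ θ≈θ' (∀ᶠ y φ) = Π-⇔ λ k → agree-⇔ (update-cong θ≈θ' y k) φ
    agree-⇔ θ≈θ' (∃ᶠ y φ) = ∃-⇔ λ k → agree-⇔ (update-cong θ≈θ' y k) φ

    agreeP-⇔ : ∀ {π θ θ'} → θ ≈ₐ θ' → ∀ χ → SatP M π θ χ ⇔ SatP M π θ' χ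
    agreeP-⇔ θ≈θ' (Xᶠ φ)   = agree-⇔ θ≈θ' φ
    agreeP-⇔ θ≈θ' (Gᶠ φ)   = Π-⇔ λ i → agree-⇔ θ≈θ' φ
    agreeP-⇔ θ≈θ' (φ Uᶠ ψ) =
      ∃-⇔ λ j → agree-⇔ θ≈θ' ψ ×-⇔ Π-⇔ λ i → Π-⇔ λ i<j → agree-⇔ θ≈θ' φ

  mutual
    substitution : ∀ y k φ {s θ} → Sat M s θ (subst y k φ) ⇔ Sat M s (θ [ y ↦ k ]) φ
    substitution y k ⊤ᶠ       = ⇔-id _
    substitution y k (atom p) = ⇔-id _
    substitution y k (¬ᶠ φ)   = ¬-cong-⇔ (substitution y k φ)
    substitution y k (φ ∧ᶠ ψ) = substitution y k φ ×-⇔ substitution y k ψ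
    substitution y k (φ ∨ᶠ ψ) = substitution y k φ ⊎-⇔ substitution y k ψ
    substitution y k (⟪ t₁ , t₂ ⟫ χ) {θ = θ} =
      enforce-cong (substT-sound y k t₁ θ) (substT-sound y k t₂ θ) (λ π → substitutionP y k χ)
    substitution y k (∀ᶠ y' φ) = Π-⇔ λ j → substitution-under y y' k φ j
    substitution y k (∃ᶠ y' φ) = ∃-⇔ λ j → substitution-under y y' k φ j

    substitution-under : ∀ y y' k φ j {s θ} →
      Sat M s (θ [ y' ↦ j ]) (if y ==ᵥ y' then φ else subst y k φ) ⇔
      Sat M s (θ [ y ↦ k ] [ y' ↦ j ]) φ
    substitution-under y₁ y₁ k φ j {θ = θ} = agree-⇔ (update-overwrite θ y₁ k j) φ
    substitution-under y₂ y₂ k φ j {θ = θ} = agree-⇔ (update-overwrite θ y₂ k j) φ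
    substitution-under y₁ y₂ k φ j {θ = θ} =
      agree-⇔ (update-swap θ y₁ k j) φ ⇔-∘ substitution y₁ k φ
    substitution-under y₂ y₁ k φ j {θ = θ} =
      agree-⇔ (update-swap θ y₂ k j) φ ⇔-∘ substitution y₂ k φ

    substitutionP : ∀ y k χ {π θ} → SatP M π θ (substP y k χ) ⇔ SatP M π (θ [ y ↦ k ]) χ
    substitutionP y k (Xᶠ φ)   = substitution y k φ
    substitutionP y k (Gᶠ φ)   = Π-⇔ λ i → substitution y k φ
    substitutionP y k (φ Uᶠ ψ) =
      ∃-⇔ λ j → substitution y k ψ ×-⇔ Π-⇔ λ i → Π-⇔ λ i<j → substitution y k φ

  mutual
    positive : ∀ y φ → WF φ → EvenOcc y true φ → ∀ {s θ θ'} →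
               Improves y θ θ' → Sat M s θ φ → Sat M s θ' φ
    positive y ⊤ᶠ       wf ev θ≼θ' h = h
    positive y (atom p) wf ev θ≼θ' h = h
    positive y (¬ᶠ φ)   wf ev θ≼θ' h h' = h (negative y φ wf ev θ≼θ' h')
    positive y (φ ∧ᶠ ψ) (wf , wf') (ev , ev') θ≼θ' =
      Data.Product.map (positive y φ wf ev θ≼θ') (positive y ψ wf' ev' θ≼θ')
    positive y (φ ∨ᶠ ψ) (wf , wf') (ev , ev') θ≼θ' =
      Data.Sum.map (positive y φ wf ev θ≼θ') (positive y ψ wf' ev' θ≼θ')
    positive y (⟪ t₁ , t₂ ⟫ χ) (t₁≢y₂ , t₂≢y₁ , wf) (_ , _ , ev) θ≼θ' =
      enforce-mono (coalition-grows θ≼θ' t₁ t₁≢y₂) (opponents-shrink θ≼θ' t₂ t₂≢y₁)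
                   (λ π → positiveP y χ wf ev θ≼θ')
    positive y (∀ᶠ y' φ) (_ , wf) ev θ≼θ' h j = positive-under y y' φ wf ev θ≼θ' j (h j)
    positive y (∃ᶠ y' φ) (_ , wf) ev θ≼θ' (j , h) = j , positive-under y y' φ wf ev θ≼θ' j h

    positive-under : ∀ y y' φ → WF φ → EvenOcc y true (∀ᶠ y' φ) → ∀ {s θ θ'} →
      Improves y θ θ' → ∀ j → Sat M s (θ [ y' ↦ j ]) φ → Sat M s (θ' [ y' ↦ j ]) φ
    positive-under y₁ y₁ φ wf ev θ≼θ' j = to (agree-⇔ (rebind-same θ≼θ' j) φ)
    positive-under y₂ y₂ φ wf ev θ≼θ' j = to (agree-⇔ (rebind-same θ≼θ' j) φ)
    positive-under y₁ y₂ φ wf ev θ≼θ' j = positive y₁ φ wf ev (rebind-other θ≼θ' j)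
    positive-under y₂ y₁ φ wf ev θ≼θ' j = positive y₂ φ wf ev (rebind-other θ≼θ' j)

    positiveP : ∀ y χ → WFP χ → EvenOccP y true χ → ∀ {π θ θ'} →
                Improves y θ θ' → SatP M π θ χ → SatP M π θ' χ
    positiveP y (Xᶠ φ) wf ev θ≼θ' h = positive y φ wf ev θ≼θ' h
    positiveP y (Gᶠ φ) wf ev θ≼θ' h i = positive y φ wf ev θ≼θ' (h i)
    positiveP y (φ Uᶠ ψ) (wf , wf') (ev , ev') θ≼θ' (j , h , before) =
      j , positive y ψ wf' ev' θ≼θ' h , λ i i<j → positive y φ wf ev θ≼θ' (before i i<j)

    -- at a negative position y may occur as neither coalition nor
    -- opponent term, so both counts are unchanged
    negative : ∀ y φ → WF φ → EvenOcc y false φ → ∀ {s θ θ'} →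
               Improves y θ θ' → Sat M s θ' φ → Sat M s θ φ
    negative y ⊤ᶠ       wf ev θ≼θ' h = h
    negative y (atom p) wf ev θ≼θ' h = h
    negative y (¬ᶠ φ)   wf ev θ≼θ' h h' = h (positive y φ wf ev θ≼θ' h')
    negative y (φ ∧ᶠ ψ) (wf , wf') (ev , ev') θ≼θ' =
      Data.Product.map (negative y φ wf ev θ≼θ') (negative y ψ wf' ev' θ≼θ')
    negative y (φ ∨ᶠ ψ) (wf , wf') (ev , ev') θ≼θ' =
      Data.Sum.map (negative y φ wf ev θ≼θ') (negative y ψ wf' ev' θ≼θ')
    negative y (⟪ t₁ , t₂ ⟫ χ) (_ , _ , wf) (t₁≢y , t₂≢y , ev) θ≼θ' =
      enforce-mono (≤-reflexive (sym (elsewhere θ≼θ' t₁ t₁≢y)))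
                   (≤-reflexive (elsewhere θ≼θ' t₂ t₂≢y))
                   (λ π → negativeP y χ wf ev θ≼θ')
    negative y (∀ᶠ y' φ) (_ , wf) ev θ≼θ' h j = negative-under y y' φ wf ev θ≼θ' j (h j)
    negative y (∃ᶠ y' φ) (_ , wf) ev θ≼θ' (j , h) = j , negative-under y y' φ wf ev θ≼θ' j h

    negative-under : ∀ y y' φ → WF φ → EvenOcc y false (∀ᶠ y' φ) → ∀ {s θ θ'} →
      Improves y θ θ' → ∀ j → Sat M s (θ' [ y' ↦ j ]) φ → Sat M s (θ [ y' ↦ j ]) φ
    negative-under y₁ y₁ φ wf ev θ≼θ' j = from (agree-⇔ (rebind-same θ≼θ' j) φ)
    negative-under y₂ y₂ φ wf ev θ≼θ' j = from (agree-⇔ (rebind-same θ≼θ' j) φ)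
    negative-under y₁ y₂ φ wf ev θ≼θ' j = negative y₁ φ wf ev (rebind-other θ≼θ' j)
    negative-under y₂ y₁ φ wf ev θ≼θ' j = negative y₂ φ wf ev (rebind-other θ≼θ' j)

    negativeP : ∀ y χ → WFP χ → EvenOccP y false χ → ∀ {π θ θ'} →
                Improves y θ θ' → SatP M π θ' χ → SatP M π θ χ
    negativeP y (Xᶠ φ) wf ev θ≼θ' h = negative y φ wf ev θ≼θ' h
    negativeP y (Gᶠ φ) wf ev θ≼θ' h i = negative y φ wf ev θ≼θ' (h i)
    negativeP y (φ Uᶠ ψ) (wf , wf') (ev , ev') θ≼θ' (j , h , before) =
      j , negative y ψ wf' ev' θ≼θ' h , λ i i<j → negative y φ wf ev θ≼θ' (before i i<j)

  -- ∀ y₁ can be instantiated with 0, the least favourable coalition size.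
  ∀y₁-elim : ∀ φ {s θ} → WF (∀ᶠ y₁ φ) → Sat M s θ (∀ᶠ y₁ φ) ⇔ Sat M s (θ [ y₁ ↦ 0 ]) φ
  ∀y₁-elim φ {θ = θ} (ev , wf) =
    mk⇔ (λ h → h 0) (λ h k → positive y₁ φ wf ev (update-improves θ y₁ z≤n) h)

  -- ∃ y₂ can be witnessed by 0, the most favourable number of opponents.
  ∃y₂-elim : ∀ φ {s θ} → WF (∃ᶠ y₂ φ) → Sat M s θ (∃ᶠ y₂ φ) ⇔ Sat M s (θ [ y₂ ↦ 0 ]) φ
  ∃y₂-elim φ {θ = θ} (ev , wf) =
    mk⇔ (λ { (k , h) → positive y₂ φ wf ev (update-improves θ y₂ z≤n) h }) (λ h → 0 , h)

  module _ {s : S} {θ : Assign} where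
    open EquationalReasoning {k = equivalence}

    item₁ : ∀ t χ → WF (∀ᶠ y₁ (⟪ ag y₁ , t ⟫ χ)) →
      Sat M s θ (∀ᶠ y₁ (⟪ ag y₁ , t ⟫ χ)) ⇔ Sat M s θ (⟪ nat 0 , t ⟫ substP y₁ 0 χ)
    item₁ t χ wf@(_ , _ , t≢y₁ , _) = begin
      Sat M s θ (∀ᶠ y₁ φ)
        ∼⟨ ∀y₁-elim φ wf ⟩
      Sat M s (θ [ y₁ ↦ 0 ]) φ
        ∼⟨ ⇔-sym (substitution y₁ 0 φ) ⟩
      Sat M s θ (⟪ nat 0 , substT y₁ 0 t ⟫ substP y₁ 0 χ)
        ≡⟨ cong (λ u → Sat M s θ (⟪ nat 0 , u ⟫ substP y₁ 0 χ)) (substT-fresh y₁ 0 t t≢y₁) ⟩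
      Sat M s θ (⟪ nat 0 , t ⟫ substP y₁ 0 χ) ∎
      where
        φ : State AP
        φ = ⟪ ag y₁ , t ⟫ χ

    item₂ : ∀ t χ → WF (∃ᶠ y₂ (⟪ t , ag y₂ ⟫ χ)) →
      Sat M s θ (∃ᶠ y₂ (⟪ t , ag y₂ ⟫ χ)) ⇔ Sat M s θ (⟪ t , nat 0 ⟫ substP y₂ 0 χ)
    item₂ t χ wf@(_ , t≢y₂ , _ , _) = begin
      Sat M s θ (∃ᶠ y₂ φ)
        ∼⟨ ∃y₂-elim φ wf ⟩
      Sat M s (θ [ y₂ ↦ 0 ]) φ
        ∼⟨ ⇔-sym (substitution y₂ 0 φ) ⟩
      Sat M s θ (⟪ substT y₂ 0 t , nat 0 ⟫ substP y₂ 0 χ)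
        ≡⟨ cong (λ u → Sat M s θ (⟪ u , nat 0 ⟫ substP y₂ 0 χ)) (substT-fresh y₂ 0 t t≢y₂) ⟩
      Sat M s θ (⟪ t , nat 0 ⟫ substP y₂ 0 χ) ∎
      where
        φ : State AP
        φ = ⟪ t , ag y₂ ⟫ χ

    item₃ : ∀ χ → WF (∀ᶠ y₁ (∃ᶠ y₂ (⟪ ag y₁ , ag y₂ ⟫ χ))) →
      Sat M s θ (∀ᶠ y₁ (∃ᶠ y₂ (⟪ ag y₁ , ag y₂ ⟫ χ))) ⇔
      Sat M s θ (⟪ nat 0 , nat 0 ⟫ substP y₂ 0 (substP y₁ 0 χ))
    item₃ χ wf = begin
      Sat M s θ (∀ᶠ y₁ (∃ᶠ y₂ φ))
        ∼⟨ ∀y₁-elim (∃ᶠ y₂ φ) wf ⟩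
      Sat M s (θ [ y₁ ↦ 0 ]) (∃ᶠ y₂ φ)
        ∼⟨ ∃y₂-elim φ (proj₂ wf) ⟩
      Sat M s (θ [ y₁ ↦ 0 ] [ y₂ ↦ 0 ]) φ
        ∼⟨ ⇔-sym (agree-⇔ (update-swap θ y₁ 0 0) φ) ⟩
      Sat M s (θ [ y₂ ↦ 0 ] [ y₁ ↦ 0 ]) φ
        ∼⟨ ⇔-sym (substitution y₁ 0 φ) ⟩
      Sat M s (θ [ y₂ ↦ 0 ]) (subst y₁ 0 φ)
        ∼⟨ ⇔-sym (substitution y₂ 0 (subst y₁ 0 φ)) ⟩
      Sat M s θ (⟪ nat 0 , nat 0 ⟫ substP y₂ 0 (substP y₁ 0 χ)) ∎
      where
        φ : State AP
        φ = ⟪ ag y₁ , ag y₂ ⟫ χ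

    item₄ : ∀ χ → WF (∃ᶠ y₂ (∀ᶠ y₁ (⟪ ag y₁ , ag y₂ ⟫ χ))) →
      Sat M s θ (∃ᶠ y₂ (∀ᶠ y₁ (⟪ ag y₁ , ag y₂ ⟫ χ))) ⇔
      Sat M s θ (⟪ nat 0 , nat 0 ⟫ substP y₂ 0 (substP y₁ 0 χ))
    item₄ χ wf = begin
      Sat M s θ (∃ᶠ y₂ (∀ᶠ y₁ φ))
        ∼⟨ ∃y₂-elim (∀ᶠ y₁ φ) wf ⟩
      Sat M s (θ [ y₂ ↦ 0 ]) (∀ᶠ y₁ φ)
        ∼⟨ ∀y₁-elim φ (proj₂ wf) ⟩
      Sat M s (θ [ y₂ ↦ 0 ] [ y₁ ↦ 0 ]) φ
        ∼⟨ ⇔-sym (substitution y₁ 0 φ) ⟩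
      Sat M s (θ [ y₂ ↦ 0 ]) (subst y₁ 0 φ)
        ∼⟨ ⇔-sym (substitution y₂ 0 (subst y₁ 0 φ)) ⟩
      Sat M s θ (⟪ nat 0 , nat 0 ⟫ substP y₂ 0 (substP y₁ 0 χ)) ∎
      where
        φ : State AP
        φ = ⟪ ag y₁ , ag y₂ ⟫ χ

    item₅ : ∀ χ → WF (∀ᶠ y₂ (∀ᶠ y₁ (⟪ ag y₁ , ag y₂ ⟫ χ))) →
      Sat M s θ (∀ᶠ y₂ (∀ᶠ y₁ (⟪ ag y₁ , ag y₂ ⟫ χ))) ⇔
      Sat M s θ (∀ᶠ y₂ (⟪ nat 0 , ag y₂ ⟫ substP y₁ 0 χ))
    item₅ χ (_ , wf) = begin
      Sat M s θ (∀ᶠ y₂ (∀ᶠ y₁ φ))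
        ∼⟨ Π-⇔ (λ j → ∀y₁-elim φ wf) ⟩
      (∀ j → Sat M s (θ [ y₂ ↦ j ] [ y₁ ↦ 0 ]) φ)
        ∼⟨ Π-⇔ (λ j → ⇔-sym (substitution y₁ 0 φ)) ⟩
      Sat M s θ (∀ᶠ y₂ (⟪ nat 0 , ag y₂ ⟫ substP y₁ 0 χ)) ∎
      where
        φ : State AP
        φ = ⟪ ag y₁ , ag y₂ ⟫ χ

    item₆ : ∀ χ → WF (∀ᶠ y₁ (∀ᶠ y₂ (⟪ ag y₁ , ag y₂ ⟫ χ))) →
      Sat M s θ (∀ᶠ y₁ (∀ᶠ y₂ (⟪ ag y₁ , ag y₂ ⟫ χ))) ⇔
      Sat M s θ (∀ᶠ y₂ (⟪ nat 0 , ag y₂ ⟫ substP y₁ 0 χ))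
    item₆ χ wf = begin
      Sat M s θ (∀ᶠ y₁ (∀ᶠ y₂ φ))
        ∼⟨ ∀y₁-elim (∀ᶠ y₂ φ) wf ⟩
      (∀ j → Sat M s (θ [ y₁ ↦ 0 ] [ y₂ ↦ j ]) φ)
        ∼⟨ Π-⇔ (λ j → ⇔-sym (agree-⇔ (update-swap θ y₁ 0 j) φ)) ⟩
      (∀ j → Sat M s (θ [ y₂ ↦ j ] [ y₁ ↦ 0 ]) φ)
        ∼⟨ Π-⇔ (λ j → ⇔-sym (substitution y₁ 0 φ)) ⟩
      Sat M s θ (∀ᶠ y₂ (⟪ nat 0 , ag y₂ ⟫ substP y₁ 0 χ)) ∎
      where
        φ : State AP
        φ = ⟪ ag y₁ , ag y₂ ⟫ χ

    item₇ : ∀ χ → WF (∃ᶠ y₁ (∃ᶠ y₂ (⟪ ag y₁ , ag y₂ ⟫ χ))) →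
      Sat M s θ (∃ᶠ y₁ (∃ᶠ y₂ (⟪ ag y₁ , ag y₂ ⟫ χ))) ⇔
      Sat M s θ (∃ᶠ y₁ (⟪ ag y₁ , nat 0 ⟫ substP y₂ 0 χ))
    item₇ χ (_ , wf) = begin
      Sat M s θ (∃ᶠ y₁ (∃ᶠ y₂ φ))
        ∼⟨ ∃-⇔ (λ k → ∃y₂-elim φ wf) ⟩
      (∃ λ k → Sat M s (θ [ y₁ ↦ k ] [ y₂ ↦ 0 ]) φ)
        ∼⟨ ∃-⇔ (λ k → ⇔-sym (substitution y₂ 0 φ)) ⟩
      Sat M s θ (∃ᶠ y₁ (⟪ ag y₁ , nat 0 ⟫ substP y₂ 0 χ)) ∎
      where
        φ : State AP
        φ = ⟪ ag y₁ , ag y₂ ⟫ χ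

    item₈ : ∀ χ → WF (∃ᶠ y₂ (∃ᶠ y₁ (⟪ ag y₁ , ag y₂ ⟫ χ))) →
      Sat M s θ (∃ᶠ y₂ (∃ᶠ y₁ (⟪ ag y₁ , ag y₂ ⟫ χ))) ⇔
      Sat M s θ (∃ᶠ y₁ (⟪ ag y₁ , nat 0 ⟫ substP y₂ 0 χ))
    item₈ χ wf = begin
      Sat M s θ (∃ᶠ y₂ (∃ᶠ y₁ φ))
        ∼⟨ ∃y₂-elim (∃ᶠ y₁ φ) wf ⟩
      (∃ λ k → Sat M s (θ [ y₂ ↦ 0 ] [ y₁ ↦ k ]) φ)
        ∼⟨ ∃-⇔ (λ k → ⇔-sym (agree-⇔ (update-swap θ y₂ 0 k) φ)) ⟩
      (∃ λ k → Sat M s (θ [ y₁ ↦ k ] [ y₂ ↦ 0 ]) φ)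
        ∼⟨ ∃-⇔ (λ k → ⇔-sym (substitution y₂ 0 φ)) ⟩
      Sat M s θ (∃ᶠ y₁ (⟪ ag y₁ , nat 0 ⟫ substP y₂ 0 χ)) ∎
      where
        φ : State AP
        φ = ⟪ ag y₁ , ag y₂ ⟫ χ

both-ways : ∀ {A B : Set} → A ⇔ B → (A → B) × (B → A)
both-ways A⇔B = to A⇔B , from A⇔B

lemma6 : ∀ {AP : Set} (t : Term) (χ : Path AP) →
    (WF (∀ᶠ y₁ (⟪ ag y₁ , t ⟫ χ)) →
      ∀ᶠ y₁ (⟪ ag y₁ , t ⟫ χ) ≋ (⟪ nat 0 , t ⟫ substP y₁ 0 χ)) ×
    (WF (∃ᶠ y₂ (⟪ t , ag y₂ ⟫ χ)) →
      ∃ᶠ y₂ (⟪ t , ag y₂ ⟫ χ) ≋ (⟪ t , nat 0 ⟫ substP y₂ 0 χ)) ×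
    (WF (∀ᶠ y₁ (∃ᶠ y₂ (⟪ ag y₁ , ag y₂ ⟫ χ))) →
      ∀ᶠ y₁ (∃ᶠ y₂ (⟪ ag y₁ , ag y₂ ⟫ χ))
        ≋ (⟪ nat 0 , nat 0 ⟫ substP y₂ 0 (substP y₁ 0 χ))) ×
    (WF (∃ᶠ y₂ (∀ᶠ y₁ (⟪ ag y₁ , ag y₂ ⟫ χ))) →
      ∃ᶠ y₂ (∀ᶠ y₁ (⟪ ag y₁ , ag y₂ ⟫ χ))
        ≋ (⟪ nat 0 , nat 0 ⟫ substP y₂ 0 (substP y₁ 0 χ))) ×
    (WF (∀ᶠ y₂ (∀ᶠ y₁ (⟪ ag y₁ , ag y₂ ⟫ χ))) →
      ∀ᶠ y₂ (∀ᶠ y₁ (⟪ ag y₁ , ag y₂ ⟫ χ))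
        ≋ ∀ᶠ y₂ (⟪ nat 0 , ag y₂ ⟫ substP y₁ 0 χ)) ×
    (WF (∀ᶠ y₁ (∀ᶠ y₂ (⟪ ag y₁ , ag y₂ ⟫ χ))) →
      ∀ᶠ y₁ (∀ᶠ y₂ (⟪ ag y₁ , ag y₂ ⟫ χ))
        ≋ ∀ᶠ y₂ (⟪ nat 0 , ag y₂ ⟫ substP y₁ 0 χ)) ×
    (WF (∃ᶠ y₁ (∃ᶠ y₂ (⟪ ag y₁ , ag y₂ ⟫ χ))) →
      ∃ᶠ y₁ (∃ᶠ y₂ (⟪ ag y₁ , ag y₂ ⟫ χ))
        ≋ ∃ᶠ y₁ (⟪ ag y₁ , nat 0 ⟫ substP y₂ 0 χ)) ×
    (WF (∃ᶠ y₂ (∃ᶠ y₁ (⟪ ag y₁ , ag y₂ ⟫ χ))) →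
      ∃ᶠ y₂ (∃ᶠ y₁ (⟪ ag y₁ , ag y₂ ⟫ χ))
        ≋ ∃ᶠ y₁ (⟪ ag y₁ , nat 0 ⟫ substP y₂ 0 χ))
lemma6 t χ =
  (λ wf n S M s θ → both-ways (Semantics.item₁ M {s} {θ} t χ wf)) ,
  (λ wf n S M s θ → both-ways (Semantics.item₂ M {s} {θ} t χ wf)) ,
  (λ wf n S M s θ → both-ways (Semantics.item₃ M {s} {θ} χ wf)) ,
  (λ wf n S M s θ → both-ways (Semantics.item₄ M {s} {θ} χ wf)) ,
  (λ wf n S M s θ → both-ways (Semantics.item₅ M {s} {θ} χ wf)) ,
  (λ wf n S M s θ → both-ways (Semantics.item₆ M {s} {θ} χ wf)) ,
  (λ wf n S M s θ → both-ways (Semantics.item₇ M {s} {θ} χ wf)) ,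
  (λ wf n S M s θ → both-ways (Semantics.item₈ M {s} {θ} χ wf))
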